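{- Let $S=\{\phi_1,\ldots,\phi_n\}$ and $T$ be finite sets of propositional formulas, let $P=\mathit{var}(S\cup T)$, and let $G=\{g_1,\ldots,g_n\}$ be new propositional variables not in $P$, where $g_i$ is associated with $\phi_i$. For $S'\subseteq S$ let $M_{S'}=\{g_i\mid \phi_i\in S'\}$. For finite sets $T_0$ and $S_0\subseteq S$ put $\mathcal{C}[T_0,S_0]=\exists P\big(T_0\wedge\bigwedge_{\phi_k\in S_0}(g_k\to\phi_k)\big)$ (with $P$ the atoms of $S\cup T$). Then $S'$ is a maximal subset of $S$ such that $T\cup S'$ is consistent if and only if $M_{S'}$ is a model of the QBF \[ \mathcal{C}[T,S]\wedge\bigwedge_{i=1}^n\Big(\neg g_i\to\neg\,\mathcal{C}[T\cup\{\phi_i\},\,S\setminus\{\phi_i\}]\Big). \]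
   Context: A finite set of formulas is identified with the conjunction of its elements; $\mathit{var}(X)$ is the set of atoms occurring in $X$. QBFs extend propositional formulas with quantifiers over atoms; $\exists P\,\Phi$ for a finite set $P$ abbreviates successive existential quantification over its elements. An interpretation $M$ is a set of atoms; truth of a QBF under $M$ is defined as usual, with $\forall p\,\Psi$ evaluated as $\Psi[p/\top]\wedge\Psi[p/\bot]$ and $\exists p\,\Psi$ as $\Psi[p/\top]\vee\Psi[p/\bot]$. $M$ is a model of $\Phi$ iff $\Phi$ is true under $M$. -}

module Defs where

open import Data.Nat using (ℕ; _≡ᵇ_)
open import Data.Bool using (Bool; true; false; _∧_; _∨_; not; if_then_else_)
open import Data.Fin using (Fin)
open import Data.Fin.Subset using (Subset; _∈_; _⊆_; ⊤; ⁅_⁆; _─_)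
open import Data.Vec using (lookup)
open import Data.List using (List; []; _∷_; _++_; foldr; map; concatMap; allFin)
open import Data.Bool.ListAction using (any)
open import Data.Product using (Σ; _×_)
open import Data.List.Relation.Unary.All using (All)
open import Relation.Binary.PropositionalEquality using (_≡_)

Atom : Set
Atom = ℕ

data Formula : Set where
  atom : Atom → Formula
  ⊤f ⊥f : Formula
  ¬f_ : Formula → Formula
  _∧f_ _∨f_ _⇒f_ : Formula → Formula → Formula

data QBF : Set where
  atom : Atom → QBF
  ⊤q ⊥q : QBF
  ¬q_ : QBF → QBF
  _∧q_ _∨q_ _⇒q_ : QBF → QBF → QBF
  ∀q ∃q : Atom → QBF → QBF

-- Interpretations: sets of atoms, given by their characteristic function.
Interp : Set
Interp = Atom → Bool

update : Interp → Atom → Bool → Interp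
update M p b q = if q ≡ᵇ p then b else M q

evalF : Formula → Interp → Bool
evalF (atom p) M = M p
evalF ⊤f M = true
evalF ⊥f M = false
evalF (¬f φ) M = not (evalF φ M)
evalF (φ ∧f ψ) M = evalF φ M ∧ evalF ψ M
evalF (φ ∨f ψ) M = evalF φ M ∨ evalF ψ M
evalF (φ ⇒f ψ) M = not (evalF φ M) ∨ evalF ψ M

-- Truth of a QBF; ∀p Ψ = Ψ[p/⊤] ∧ Ψ[p/⊥], ∃p Ψ = Ψ[p/⊤] ∨ Ψ[p/⊥]
-- (substitution of a truth value for the free occurrences of p is realised
-- by updating the interpretation at p).
evalQ : QBF → Interp → Bool
evalQ (atom p) M = M p
evalQ ⊤q M = true
evalQ ⊥q M = false
evalQ (¬q Φ) M = not (evalQ Φ M)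
evalQ (Φ ∧q Ψ) M = evalQ Φ M ∧ evalQ Ψ M
evalQ (Φ ∨q Ψ) M = evalQ Φ M ∨ evalQ Ψ M
evalQ (Φ ⇒q Ψ) M = not (evalQ Φ M) ∨ evalQ Ψ M
evalQ (∀q p Φ) M = evalQ Φ (update M p true) ∧ evalQ Φ (update M p false)
evalQ (∃q p Φ) M = evalQ Φ (update M p true) ∨ evalQ Φ (update M p false)

_⊨_ : Interp → QBF → Set
M ⊨ Φ = evalQ Φ M ≡ true

embed : Formula → QBF
embed (atom p) = atom p
embed ⊤f = ⊤q
embed ⊥f = ⊥q
embed (¬f φ) = ¬q embed φ
embed (φ ∧f ψ) = embed φ ∧q embed ψ
embed (φ ∨f ψ) = embed φ ∨q embed ψ
embed (φ ⇒f ψ) = embed φ ⇒q embed ψ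

vars : Formula → List Atom
vars (atom p) = p ∷ []
vars ⊤f = []
vars ⊥f = []
vars (¬f φ) = vars φ
vars (φ ∧f ψ) = vars φ ++ vars ψ
vars (φ ∨f ψ) = vars φ ++ vars ψ
vars (φ ⇒f ψ) = vars φ ++ vars ψ

⋀ : List QBF → QBF
⋀ = foldr _∧q_ ⊤q

∃* : List Atom → QBF → QBF
∃* P Φ = foldr ∃q Φ P

module Setting {n : ℕ} (φ : Fin n → Formula) (T : List Formula) (g : Fin n → Atom) where

  -- S = {φ_1, …, φ_n}, indexed by Fin n; subsets of S are subsets of indices.
  Sl : List Formula
  Sl = map φ (allFin n)

  P : List Atom
  P = concatMap vars (Sl ++ T)

  Consistent : Subset n → Set
  Consistent S' = Σ Interp λ M →
    All (λ ψ → evalF ψ M ≡ true) T × (∀ i → i ∈ S' → evalF (φ i) M ≡ true)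

  MaximalConsistent : Subset n → Set
  MaximalConsistent S' =
    Consistent S' × (∀ S'' → S' ⊆ S'' → Consistent S'' → S'' ⊆ S')

  M[_] : Subset n → Interp
  M[ S' ] a = any (λ i → lookup S' i ∧ (g i ≡ᵇ a)) (allFin n)

  𝒞 : List Formula → Subset n → QBF
  𝒞 T₀ S₀ = ∃* P (⋀ (map embed T₀) ∧q
    ⋀ (map (λ k → if lookup S₀ k then (atom (g k) ⇒q embed (φ k)) else ⊤q) (allFin n)))

  QBFmax : QBF
  QBFmax = 𝒞 T ⊤ ∧q
    ⋀ (map (λ i → (¬q atom (g i)) ⇒q (¬q 𝒞 (φ i ∷ T) (⊤ ─ ⁅ i ⁆))) (allFin n))

{-# OPTIONS --safe #-}
-- Under M[ S' ] the fresh atoms g k act as switches: the quantifier ∃P ranges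
-- over all valuations of var(S ∪ T) while leaving every g k fixed, so 𝒞[Γ, S₀]
-- holds exactly when Γ together with the φ k for k ∈ S₀ ∩ S' is consistent
-- (injectivity of g makes g k true in M[ S' ] exactly for k ∈ S'). Hence the
-- first conjunct of the QBF says that T ∪ S' is consistent, and the i-th clause
-- says, for φ i ∉ S', that T ∪ S' ∪ {φ i} is inconsistent. As consistency passes
-- to subsets, these one-step conditions together are equivalent to maximality.
module Submission where

open import Defs
open import Data.Nat using (ℕ; _≡ᵇ_)
open import Data.Nat.Properties using (_≟_; ≡ᵇ⇒≡; ≡⇒≡ᵇ)
open import Data.Bool using (Bool; true; false; _∧_; _∨_; not; if_then_else_)
open import Data.Bool.Properties using (T-≡; T-∧)
open import Data.Empty using (⊥-elim)
open import Data.Fin using (Fin)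
open import Data.Fin.Subset using (Subset; ⊤; ⁅_⁆; _─_; _∪_)
  renaming (_∈_ to _∈ₛ_; _∉_ to _∉ₛ_; _⊆_ to _⊆ₛ_)
open import Data.Fin.Subset.Properties
  using (∈⊤; ⊆⊤; x∈⁅x⁆; x∈⁅y⁆⇒x≡y; p⊆p∪q; x∈p∪q⁺; x∈p∪q⁻; x∈p∧x≢y⇒x∈p-y)
  renaming (_∈?_ to _∈ₛ?_)
open import Data.Vec using (lookup)
open import Data.Vec.Properties using ([]=⇒lookup; lookup⇒[]=)
open import Data.List using (List; []; _∷_; map; allFin; concatMap)
open import Data.List.Membership.Propositional using (_∈_; _∉_; lose)
open import Data.List.Membership.Propositional.Properties
  using (∈-++⁺ˡ; ∈-++⁺ʳ; ∈-map⁺; ∈-allFin; ∈-concatMap⁺)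
open import Data.List.Membership.DecPropositional _≟_ using (_∈?_)
open import Data.List.Relation.Binary.Subset.Propositional using (_⊆_)
open import Data.List.Relation.Unary.All as All using (All; []; _∷_)
open import Data.List.Relation.Unary.All.Properties using (map⁺; map⁻; tabulate⁺; tabulate⁻)
open import Data.List.Relation.Unary.Any using (here; there; satisfied)
open import Data.List.Relation.Unary.Any.Properties using (any⁺; any⁻)
open import Data.Product using (Σ; ∃; _×_; _,_; proj₂)
open import Data.Product.Function.NonDependent.Propositional using (_×-⇔_)
open import Data.Sum using (_⊎_; inj₁; inj₂; [_,_]′)
open import Function using (_∘_; _$_; id; const)
open import Function.Definitions using (Injective)
open import Function.Related.TypeIsomorphisms using (¬-cong-⇔)
open import Function.Bundles using (_⇔_; mk⇔; Equivalence)
open import Function.Properties.Equivalence using () renaming (trans to ⇔-trans; sym to ⇔-sym)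
open import Relation.Nullary using (¬_; yes; no; contradiction)
open import Relation.Nullary.Decidable using (does; decidable-stable)
open import Relation.Binary.PropositionalEquality
  using (_≡_; _≢_; _≗_; refl; sym; trans; cong; cong₂; subst)

open Equivalence using (to; from)

private variable
  M M' : Interp
  Φ : QBF
  p a : Atom
  b : Bool
  Ps : List Atom
  ψ : Formula
  Γ : List Formula

_⊨ᶠ_ : Interp → Formula → Set
M ⊨ᶠ ψ = evalF ψ M ≡ true

∧≡true : ∀ x y → x ∧ y ≡ true ⇔ (x ≡ true × y ≡ true)
∧≡true true  y = mk⇔ (refl ,_) proj₂
∧≡true false y = mk⇔ (λ ()) (λ { (() , _) })

∨≡true : ∀ x y → x ∨ y ≡ true ⇔ (x ≡ true ⊎ y ≡ true)
∨≡true true  y = mk⇔ (const (inj₁ refl)) (const refl)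
∨≡true false y = mk⇔ inj₂ [ (λ ()) , id ]′

not≡true : ∀ x → not x ≡ true ⇔ (¬ x ≡ true)
not≡true true  = mk⇔ (λ ()) (λ x≢true → ⊥-elim (x≢true refl))
not≡true false = mk⇔ (λ _ ()) (const refl)

implies≡true : ∀ x y → not x ∨ y ≡ true ⇔ (x ≡ true → y ≡ true)
implies≡true true  y = mk⇔ const (_$ refl)
implies≡true false y = mk⇔ (λ _ ()) (const refl)

update-≡ : update M p b p ≡ b
update-≡ {p = p} rewrite to T-≡ (≡⇒≡ᵇ p p refl) = refl

update-≢ : a ≢ p → update M p b a ≡ M a
update-≢ {a = a} {p = p} a≢p with a ≡ᵇ p in a≡ᵇp
... | true  = contradiction (≡ᵇ⇒≡ a p (from T-≡ a≡ᵇp)) a≢p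
... | false = refl

update-cong : M ≗ M' → update M p b ≗ update M' p b
update-cong {p = p} M≗M' a with a ≡ᵇ p
... | true  = refl
... | false = M≗M' a

override : List Atom → Interp → Interp → Interp
override Ps M' M a = if does (a ∈? Ps) then M' a else M a

override-∈ : ∀ Ps M' M → a ∈ Ps → override Ps M' M a ≡ M' a
override-∈ {a = a} Ps M' M a∈Ps with a ∈? Ps
... | yes _    = refl
... | no a∉Ps = contradiction a∈Ps a∉Ps

override-∉ : ∀ Ps M' M → a ∉ Ps → override Ps M' M a ≡ M a
override-∉ {a = a} Ps M' M a∉Ps with a ∈? Ps
... | yes a∈Ps = contradiction a∈Ps a∉Ps
... | no _     = refl

AgreeOutside : List Atom → Interp → Interp → Set
AgreeOutside Ps M M' = ∀ {a} → a ∉ Ps → M a ≡ M' a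

evalQ-cong : ∀ Φ → M ≗ M' → evalQ Φ M ≡ evalQ Φ M'
evalQ-cong (atom p)  M≗M' = M≗M' p
evalQ-cong ⊤q        M≗M' = refl
evalQ-cong ⊥q        M≗M' = refl
evalQ-cong (¬q Φ)    M≗M' = cong not (evalQ-cong Φ M≗M')
evalQ-cong (Φ ∧q Ψ)  M≗M' = cong₂ _∧_ (evalQ-cong Φ M≗M') (evalQ-cong Ψ M≗M')
evalQ-cong (Φ ∨q Ψ)  M≗M' = cong₂ _∨_ (evalQ-cong Φ M≗M') (evalQ-cong Ψ M≗M')
evalQ-cong (Φ ⇒q Ψ)  M≗M' = cong₂ (λ x y → not x ∨ y) (evalQ-cong Φ M≗M') (evalQ-cong Ψ M≗M')
evalQ-cong (∀q p Φ)  M≗M' =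
  cong₂ _∧_ (evalQ-cong Φ (update-cong M≗M')) (evalQ-cong Φ (update-cong M≗M'))
evalQ-cong (∃q p Φ)  M≗M' =
  cong₂ _∨_ (evalQ-cong Φ (update-cong M≗M')) (evalQ-cong Φ (update-cong M≗M'))

evalF-local : ∀ ψ → (∀ {a} → a ∈ vars ψ → M a ≡ M' a) → evalF ψ M ≡ evalF ψ M'
evalF-local (atom p) M≡M' = M≡M' (here refl)
evalF-local ⊤f       M≡M' = refl
evalF-local ⊥f       M≡M' = refl
evalF-local (¬f ψ)   M≡M' = cong not (evalF-local ψ M≡M')
evalF-local (ψ ∧f χ) M≡M' =
  cong₂ _∧_ (evalF-local ψ (M≡M' ∘ ∈-++⁺ˡ)) (evalF-local χ (M≡M' ∘ ∈-++⁺ʳ (vars ψ)))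
evalF-local (ψ ∨f χ) M≡M' =
  cong₂ _∨_ (evalF-local ψ (M≡M' ∘ ∈-++⁺ˡ)) (evalF-local χ (M≡M' ∘ ∈-++⁺ʳ (vars ψ)))
evalF-local (ψ ⇒f χ) M≡M' =
  cong₂ (λ x y → not x ∨ y) (evalF-local ψ (M≡M' ∘ ∈-++⁺ˡ)) (evalF-local χ (M≡M' ∘ ∈-++⁺ʳ (vars ψ)))

evalF-override : ∀ ψ → vars ψ ⊆ Ps → evalF ψ (override Ps M' M) ≡ evalF ψ M'
evalF-override {Ps = Ps} {M' = M'} {M = M} ψ vars⊆Ps =
  evalF-local ψ (override-∈ Ps M' M ∘ vars⊆Ps)

evalQ-embed : ∀ ψ → evalQ (embed ψ) M ≡ evalF ψ M
evalQ-embed (atom p) = refl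
evalQ-embed ⊤f       = refl
evalQ-embed ⊥f       = refl
evalQ-embed (¬f ψ)   = cong not (evalQ-embed ψ)
evalQ-embed (ψ ∧f χ) = cong₂ _∧_ (evalQ-embed ψ) (evalQ-embed χ)
evalQ-embed (ψ ∨f χ) = cong₂ _∨_ (evalQ-embed ψ) (evalQ-embed χ)
evalQ-embed (ψ ⇒f χ) = cong₂ (λ x y → not x ∨ y) (evalQ-embed ψ) (evalQ-embed χ)

⊨-embed : ∀ ψ → M ⊨ embed ψ ⇔ M ⊨ᶠ ψ
⊨-embed ψ = mk⇔ (trans (sym (evalQ-embed ψ))) (trans (evalQ-embed ψ))

⊨-⋀ : ∀ Φs → M ⊨ ⋀ Φs ⇔ All (M ⊨_) Φs
⊨-⋀ []       = mk⇔ (const []) (const refl)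
⊨-⋀ (Φ ∷ Φs) = mk⇔
  (λ h → let (M⊨Φ , M⊨Φs) = to (∧≡true _ _) h in M⊨Φ ∷ to (⊨-⋀ Φs) M⊨Φs)
  (λ { (M⊨Φ ∷ M⊨Φs) → from (∧≡true _ _) (M⊨Φ , from (⊨-⋀ Φs) M⊨Φs) })

⊨-⋀allFin : ∀ {n} (f : Fin n → QBF) → M ⊨ ⋀ (map f (allFin n)) ⇔ (∀ i → M ⊨ f i)
⊨-⋀allFin f = mk⇔ (tabulate⁻ ∘ map⁻ ∘ to (⊨-⋀ _)) (from (⊨-⋀ _) ∘ map⁺ ∘ tabulate⁺)

⊨-⋀embed : ∀ Γ → M ⊨ ⋀ (map embed Γ) ⇔ All (M ⊨ᶠ_) Γ
⊨-⋀embed Γ = mk⇔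
  (All.map (λ {ψ} → to (⊨-embed ψ)) ∘ map⁻ ∘ to (⊨-⋀ _))
  (from (⊨-⋀ _) ∘ map⁺ ∘ All.map (λ {ψ} → from (⊨-embed ψ)))

⊨-if : ∀ b → M ⊨ (if b then Φ else ⊤q) ⇔ (b ≡ true → M ⊨ Φ)
⊨-if true  = mk⇔ const (_$ refl)
⊨-if false = mk⇔ (λ _ ()) (const refl)

⊨-guard : ∀ {n} (S : Subset n) k → M ⊨ (if lookup S k then Φ else ⊤q) ⇔ (k ∈ₛ S → M ⊨ Φ)
⊨-guard S k = mk⇔
  (λ h k∈S → to (⊨-if _) h ([]=⇒lookup k∈S))
  (λ f → from (⊨-if _) (f ∘ lookup⇒[]= k S))

⊨-∃q : M ⊨ ∃q p Φ ⇔ (∃ λ b → update M p b ⊨ Φ)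
⊨-∃q {M = M} {p = p} {Φ = Φ} = mk⇔
  ([ (true ,_) , (false ,_) ]′ ∘ to ∨-split)
  (λ { (true , h) → from ∨-split (inj₁ h) ; (false , h) → from ∨-split (inj₂ h) })
  where ∨-split = ∨≡true (evalQ Φ (update M p true)) (evalQ Φ (update M p false))

∃*-elim : ∀ Ps → M ⊨ ∃* Ps Φ → ∃ λ M' → AgreeOutside Ps M' M × M' ⊨ Φ
∃*-elim []       M⊨Φ = _ , const refl , M⊨Φ
∃*-elim {M = M} {Φ = Φ} (p ∷ Ps) h with to (⊨-∃q {Φ = ∃* Ps Φ}) h
... | b , h′ with ∃*-elim Ps h′
... | M' , agree , M'⊨Φ =
  M' , (λ a∉ → trans (agree (a∉ ∘ there)) (update-≢ {M = M} (a∉ ∘ here))) , M'⊨Φ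

∃*-intro : ∀ Ps → AgreeOutside Ps M' M → M' ⊨ Φ → M ⊨ ∃* Ps Φ
∃*-intro {Φ = Φ} [] agree M'⊨Φ = trans (evalQ-cong Φ (λ _ → sym (agree λ ()))) M'⊨Φ
∃*-intro {M' = M'} {M = M} {Φ = Φ} (p ∷ Ps) agree M'⊨Φ =
  from (⊨-∃q {Φ = ∃* Ps Φ}) (M' p , ∃*-intro Ps agree′ M'⊨Φ)
  where
  agree′ : AgreeOutside Ps M' (update M p (M' p))
  agree′ {a} a∉Ps with a ≟ p
  ... | yes refl = sym (update-≡ {M = M})
  ... | no a≢p   = trans (agree λ { (here a≡p) → a≢p a≡p ; (there a∈Ps) → a∉Ps a∈Ps })
                         (sym (update-≢ {M = M} a≢p))

⊨-∃* : ∀ Ps → M ⊨ ∃* Ps Φ ⇔ (∃ λ M' → AgreeOutside Ps M' M × M' ⊨ Φ)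
⊨-∃* Ps = mk⇔ (∃*-elim Ps) (λ (_ , agree , M'⊨Φ) → ∃*-intro Ps agree M'⊨Φ)

vars⊆concatMap : ψ ∈ Γ → vars ψ ⊆ concatMap vars Γ
vars⊆concatMap ψ∈Γ a∈vars = ∈-concatMap⁺ vars (lose ψ∈Γ a∈vars)

module _ {n} (φ : Fin n → Formula) (T : List Formula) (g : Fin n → Atom) where
  open Setting φ T g

  -- Consistent S' is definitionally Satisfiable T (_∈ₛ S').
  Satisfiable : List Formula → (Fin n → Set) → Set
  Satisfiable Γ A = Σ Interp λ M → All (M ⊨ᶠ_) Γ × (∀ k → A k → M ⊨ᶠ φ k)

  Satisfiable-cong : ∀ {A B : Fin n → Set} → (∀ {k} → A k ⇔ B k) → Satisfiable Γ A ⇔ Satisfiable Γ B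
  Satisfiable-cong A⇔B = mk⇔
    (λ (M , M⊨Γ , M⊨A) → M , M⊨Γ , λ k → M⊨A k ∘ from A⇔B)
    (λ (M , M⊨Γ , M⊨B) → M , M⊨Γ , λ k → M⊨B k ∘ to A⇔B)

  Unextendable : Subset n → Set
  Unextendable S' = ∀ i → i ∉ₛ S' → ¬ Satisfiable (φ i ∷ T) (_∈ₛ S')

  maximal⇔consistent-unextendable : ∀ S' → MaximalConsistent S' ⇔ (Consistent S' × Unextendable S')
  maximal⇔consistent-unextendable S' = mk⇔ to′ from′
    where
    to′ : MaximalConsistent S' → Consistent S' × Unextendable S'
    to′ (cons , maximal) = cons , unextendable
      where
      unextendable : Unextendable S'
      unextendable i i∉S' (M , M⊨φi ∷ M⊨T , M⊨S') =
        i∉S' (maximal (S' ∪ ⁅ i ⁆) (p⊆p∪q ⁅ i ⁆) (M , M⊨T , M⊨S'∪i) (x∈p∪q⁺ (inj₂ (x∈⁅x⁆ i))))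
        where
        M⊨S'∪i : ∀ k → k ∈ₛ S' ∪ ⁅ i ⁆ → M ⊨ᶠ φ k
        M⊨S'∪i k k∈ = [ M⊨S' k , (λ k∈⁅i⁆ → subst (λ j → M ⊨ᶠ φ j) (sym (x∈⁅y⁆⇒x≡y i k∈⁅i⁆)) M⊨φi) ]′
          (x∈p∪q⁻ S' ⁅ i ⁆ k∈)

    from′ : Consistent S' × Unextendable S' → MaximalConsistent S'
    from′ (cons , unextendable) = cons , λ S'' S'⊆S'' (M , M⊨T , M⊨S'') {i} i∈S'' →
      decidable-stable (i ∈ₛ? S') λ i∉S' →
        unextendable i i∉S' (M , M⊨S'' i i∈S'' ∷ M⊨T , λ k → M⊨S'' k ∘ S'⊆S'')

  vars-φ⊆P : ∀ k → vars (φ k) ⊆ P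
  vars-φ⊆P k = vars⊆concatMap (∈-++⁺ˡ (∈-map⁺ φ (∈-allFin k)))

  vars-T⊆P : All (λ ψ → vars ψ ⊆ P) T
  vars-T⊆P = All.tabulate (vars⊆concatMap ∘ ∈-++⁺ʳ Sl)

  M[]-g⇔∈ : Injective _≡_ _≡_ g → ∀ {S' k} → M[ S' ] (g k) ≡ true ⇔ k ∈ₛ S'
  M[]-g⇔∈ g-inj {S'} {k} = mk⇔ to′ from′
    where
    to′ : M[ S' ] (g k) ≡ true → k ∈ₛ S'
    to′ h with satisfied (any⁻ _ (allFin n) (from T-≡ h))
    ... | j , selected with to T-∧ selected
    ... | j∈S' , gj≡ᵇgk =
      subst (_∈ₛ S') (g-inj (≡ᵇ⇒≡ (g j) (g k) gj≡ᵇgk)) (lookup⇒[]= j S' (to T-≡ j∈S'))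

    from′ : k ∈ₛ S' → M[ S' ] (g k) ≡ true
    from′ k∈S' = to T-≡ (any⁺ _ (lose (∈-allFin k)
      (from T-∧ (from T-≡ ([]=⇒lookup k∈S') , ≡⇒≡ᵇ (g k) (g k) refl))))

  ⊨-𝒞 : (∀ k → g k ∉ P) → All (λ ψ → vars ψ ⊆ P) Γ → ∀ {M S₀} →
        M ⊨ 𝒞 Γ S₀ ⇔ Satisfiable Γ (λ k → k ∈ₛ S₀ × M (g k) ≡ true)
  ⊨-𝒞 {Γ} g∉P Γ⊆P {M} {S₀} = mk⇔ extract build
    where
    guard : Fin n → QBF
    guard k = if lookup S₀ k then (atom (g k) ⇒q embed (φ k)) else ⊤q

    extract : M ⊨ 𝒞 Γ S₀ → Satisfiable Γ (λ k → k ∈ₛ S₀ × M (g k) ≡ true)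
    extract M⊨𝒞 with to (⊨-∃* P) M⊨𝒞
    ... | M' , M'≈M , M'⊨body with to (∧≡true _ _) M'⊨body
    ... | M'⊨Γ , M'⊨guards = M' , to (⊨-⋀embed Γ) M'⊨Γ , M'⊨selected
      where
      M'⊨selected : ∀ k → k ∈ₛ S₀ × M (g k) ≡ true → M' ⊨ᶠ φ k
      M'⊨selected k (k∈S₀ , M⊨gₖ) = to (⊨-embed (φ k))
        (to (implies≡true _ _) (to (⊨-guard S₀ k) (to (⊨-⋀allFin _) M'⊨guards k) k∈S₀)
                               (trans (M'≈M (g∉P k)) M⊨gₖ))

    -- Since every g k lies outside P, the guards of M'' read M while the formulas read M'.
    build : Satisfiable Γ (λ k → k ∈ₛ S₀ × M (g k) ≡ true) → M ⊨ 𝒞 Γ S₀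
    build (M' , M'⊨Γ , M'⊨selected) =
      from (⊨-∃* P) (M'' , override-∉ P M' M , from (∧≡true _ _) (M''⊨Γ , M''⊨guards))
      where
      M'' : Interp
      M'' = override P M' M

      M''⊨ψ : ∀ {ψ} → vars ψ ⊆ P × M' ⊨ᶠ ψ → M'' ⊨ᶠ ψ
      M''⊨ψ {ψ} (vars⊆P , M'⊨ψ) = trans (evalF-override ψ vars⊆P) M'⊨ψ

      M''⊨Γ : M'' ⊨ ⋀ (map embed Γ)
      M''⊨Γ = from (⊨-⋀embed Γ) (All.zipWith (λ {ψ} → M''⊨ψ {ψ}) (Γ⊆P , M'⊨Γ))

      M''⊨guards : M'' ⊨ ⋀ (map guard (allFin n))
      M''⊨guards = from (⊨-⋀allFin _) λ k → from (⊨-guard S₀ k) λ k∈S₀ →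
        from (implies≡true _ _) λ M''⊨gₖ → from (⊨-embed (φ k)) (M''⊨ψ {φ k} (vars-φ⊆P k ,
          M'⊨selected k (k∈S₀ , trans (sym (override-∉ P M' M (g∉P k))) M''⊨gₖ)))

  module _ (g-inj : Injective _≡_ _≡_ g) (g∉P : ∀ k → g k ∉ P) (S' : Subset n) where

    M[]⊨𝒞 : ∀ {S₀} → All (λ ψ → vars ψ ⊆ P) Γ → S' ⊆ₛ S₀ →
            M[ S' ] ⊨ 𝒞 Γ S₀ ⇔ Satisfiable Γ (_∈ₛ S')
    M[]⊨𝒞 Γ⊆P S'⊆S₀ = ⇔-trans (⊨-𝒞 g∉P Γ⊆P) (Satisfiable-cong (mk⇔
      (to (M[]-g⇔∈ g-inj) ∘ proj₂)
      (λ k∈S' → S'⊆S₀ k∈S' , from (M[]-g⇔∈ g-inj) k∈S')))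

    M[]⊨exclusion⇔ : ∀ i → M[ S' ] ⊨ ((¬q atom (g i)) ⇒q (¬q 𝒞 (φ i ∷ T) (⊤ ─ ⁅ i ⁆))) ⇔
                          (i ∉ₛ S' → ¬ Satisfiable (φ i ∷ T) (_∈ₛ S'))
    M[]⊨exclusion⇔ i = mk⇔
      (λ h i∉S' → to (not≡true _) (to (implies≡true _ _) h (from ¬gᵢ⇔ i∉S')) ∘ from (𝒞ᵢ⇔ i∉S'))
      (λ f → from (implies≡true _ _) λ M⊨¬gᵢ →
        let i∉S' = to ¬gᵢ⇔ M⊨¬gᵢ in from (not≡true _) (f i∉S' ∘ to (𝒞ᵢ⇔ i∉S')))
      where
      ¬gᵢ⇔ : M[ S' ] ⊨ (¬q atom (g i)) ⇔ i ∉ₛ S'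
      ¬gᵢ⇔ = ⇔-trans (not≡true _) (¬-cong-⇔ (M[]-g⇔∈ g-inj))

      𝒞ᵢ⇔ : i ∉ₛ S' → M[ S' ] ⊨ 𝒞 (φ i ∷ T) (⊤ ─ ⁅ i ⁆) ⇔ Satisfiable (φ i ∷ T) (_∈ₛ S')
      𝒞ᵢ⇔ i∉S' = M[]⊨𝒞 {S₀ = ⊤ ─ ⁅ i ⁆} (vars-φ⊆P i ∷ vars-T⊆P)
        λ k∈S' → x∈p∧x≢y⇒x∈p-y ∈⊤ λ { refl → i∉S' k∈S' }

    M[]⊨QBFmax⇔ : M[ S' ] ⊨ QBFmax ⇔ (Consistent S' × Unextendable S')
    M[]⊨QBFmax⇔ = ⇔-trans (∧≡true _ _) (M[]⊨𝒞 vars-T⊆P ⊆⊤ ×-⇔ ⇔-trans (⊨-⋀allFin _) (mk⇔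
      (λ exclusions i → to (M[]⊨exclusion⇔ i) (exclusions i))
      (λ unextendable i → from (M[]⊨exclusion⇔ i) (unextendable i))))

theorem1 : (n : ℕ) (φ : Fin n → Formula) (T : List Formula) (g : Fin n → Atom)
    → Injective _≡_ _≡_ φ
    → Injective _≡_ _≡_ g
    → (∀ i → g i ∉ Setting.P φ T g)
    → (S' : Subset n)
    → Setting.MaximalConsistent φ T g S' ⇔ (Setting.M[_] φ T g S' ⊨ Setting.QBFmax φ T g)
theorem1 n φ T g _ g-inj g∉P S' =
  ⇔-trans (maximal⇔consistent-unextendable φ T g S') (⇔-sym (M[]⊨QBFmax⇔ φ T g g-inj g∉P S'))
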